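{- Let $d\ge2$, $r\in\{1,\dots,d-1\}$ with $\gcd(r,d)=1$, and $1\le i,j\le d-1$. Then $\tilde H_{ij}$ is a nonzero homogeneous polynomial of total degree $d$ in $\mathbb Q[A_1,\dots,A_d]$, and $h_{\vec m,i,j}\in\mathbb Q^*$ for every $\vec m\in\mathcal M_{ij}$.
   Context: For an integer $c$, $(c\bmod d)$ denotes the representative in $\{0,\dots,d-1\}$. Put $r_{ij}=(-(ri-j)\bmod d)$ and $r'_{i1}=(ri-1\bmod d)$; let $\delta_{ij}=0$ if $j<r'_{i1}+1$ and $\delta_{ij}=1$ if $j\ge r'_{i1}+1$. Let $\mathcal M_{ij}=\{\vec m=(m_1,\dots,m_d)\in\mathbb Z_{\ge0}^d:\sum_{k=1}^{d-1}(d-k)m_k=r_{ij},\ \sum_{k=1}^dm_k=d\}$. For $\vec m\in\mathcal M_{ij}$ let $h_{\vec m,i,j}=\dfrac{\prod_{t=0}^{\sum_{k=1}^{d-1}m_k+\delta_{ij}-1}\left(\frac{r_{i1}-1}{d}-t\right)}{\prod_{k=1}^{d-1}m_k!}$, and $\tilde H_{ij}=\sum_{\vec m\in\mathcal M_{ij}}h_{\vec m,i,j}A_1^{m_1}\cdots A_d^{m_d}$. -}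

module Defs where

open import Data.Nat as ℕ using (ℕ; zero; suc; _∸_; _<?_; _≟_; NonZero; _!)
open import Data.Nat.Properties using (_!≢0)
open import Data.Integer as ℤ using (ℤ; +_)
open import Data.Integer.DivMod using (_%ℕ_)
open import Data.Rational as ℚ using (ℚ; 0ℚ; 1ℚ)
open import Data.Fin using (Fin; toℕ)
open import Data.List using (List; foldr; map; upTo; allFin; filter)
open import Data.Bool using (Bool; if_then_else_; _∧_)
open import Data.Product using (∃)
open import Relation.Nullary using (does)
open import Relation.Binary.PropositionalEquality using (_≡_; _≢_)

-- Exponent vectors / monomials in A_1,…,A_d : the paper's A_k (k = 1..d)
-- corresponds to the index x : Fin d with k = toℕ x + 1.
Exps : ℕ → Set
Exps d = Fin d → ℕ

Poly : ℕ → Set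
Poly d = Exps d → ℚ

ΣL : {A : Set} → List A → (A → ℕ) → ℕ
ΣL xs f = foldr (λ x acc → f x ℕ.+ acc) 0 xs

ΠQ : {A : Set} → List A → (A → ℚ) → ℚ
ΠQ xs f = foldr (λ x acc → f x ℚ.* acc) 1ℚ xs

lowIdx : (d : ℕ) → List (Fin d)
lowIdx d = filter (λ x → suc (toℕ x) <? d) (allFin d)

totDeg : {d : ℕ} → Exps d → ℕ
totDeg {d} m = ΣL (allFin d) m

modd : ℤ → (d : ℕ) → .{{_ : NonZero d}} → ℕ
modd c d = c %ℕ d

rr : (d : ℕ) .{{_ : NonZero d}} → (r i j : ℕ) → ℕ
rr d r i j = modd (ℤ.- ((+ (r ℕ.* i)) ℤ.- (+ j))) d

rr' : (d : ℕ) .{{_ : NonZero d}} → (r i : ℕ) → ℕ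
rr' d r i = modd ((+ (r ℕ.* i)) ℤ.- (+ 1)) d

δ : (d : ℕ) .{{_ : NonZero d}} → (r i j : ℕ) → ℕ
δ d r i j = if does (j <? suc (rr' d r i)) then 0 else 1

InM : (d : ℕ) .{{_ : NonZero d}} → (r i j : ℕ) → Exps d → Set
InM d r i j m =
  (ΣL (lowIdx d) (λ x → (d ∸ suc (toℕ x)) ℕ.* m x) ≡ rr d r i j) Data.Product.×
  (totDeg m ≡ d)

inMᵇ : (d : ℕ) .{{_ : NonZero d}} → (r i j : ℕ) → Exps d → Bool
inMᵇ d r i j m =
  does (ΣL (lowIdx d) (λ x → (d ∸ suc (toℕ x)) ℕ.* m x) ≟ rr d r i j)
  ∧ does (totDeg m ≟ d)

hcoef : (d : ℕ) .{{_ : NonZero d}} → (r i j : ℕ) → Exps d → ℚ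
hcoef d r i j m =
  ΠQ (upTo (ΣL (lowIdx d) m ℕ.+ δ d r i j))
     (λ t → (((+ rr d r i 1) ℤ.- (+ 1)) ℚ./ d) ℚ.- ((+ t) ℚ./ 1))
  ℚ.* ΠQ (lowIdx d) (λ x → ((+ 1) ℚ./ (m x !)) {{m x !≢0}})

Htilde : (d : ℕ) .{{_ : NonZero d}} → (r i j : ℕ) → Poly d
Htilde d r i j m = if inMᵇ d r i j m then hcoef d r i j m else 0ℚ

IsNonzeroPoly : {d : ℕ} → Poly d → Set
IsNonzeroPoly P = ∃ λ e → P e ≢ 0ℚ

IsHomogeneous : {d : ℕ} → Poly d → ℕ → Set
IsHomogeneous P n = ∀ e → P e ≢ 0ℚ → totDeg e ≡ n

-- The coefficients h are nonzero because (r_{i1} - 1)/d is never a natural number t: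
-- otherwise r_{i1} = (1 - ri) mod d would be congruent to 1, so d would divide ri,
-- impossible for r coprime to d and 0 < i < d. The support of H̃ is 𝓜_{ij} by
-- construction, so H̃ is homogeneous of degree d, and it is nonzero since 𝓜_{ij}
-- contains (d-1)A_d + A_{d-r_{ij}}, of weight Σ (d-k) m_k = r_{ij}.
module Submission where

open import Defs
open import Data.Nat using (ℕ; _≤_; _∸_; NonZero)
open import Data.Nat.GCD using (gcd)
open import Data.Rational using (0ℚ)
open import Data.Product using (_×_)
open import Relation.Binary.PropositionalEquality using (_≡_; _≢_)

open import Data.Nat as ℕ using (zero; suc; _<_; _+_; _*_; s≤s; _!)
open import Data.Nat.Properties as ℕP using (_!≢0)
open import Data.Nat.Divisibility using (_∤_; ∣⇒≤)
open import Data.Nat.Coprimality using (Coprime; gcd≡1⇒coprime; coprime-divisor)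
import Data.Nat.Coprimality as Coprimality
import Data.Nat.Tactic.RingSolver as ℕSolver
open import Data.Integer as ℤ using (+_)
import Data.Integer.Properties as ℤP
open import Data.Integer.DivMod using (_%ℕ_; _/ℕ_; a≡a%ℕn+[a/ℕn]*n; n%ℕd<d)
open import Data.Integer.Divisibility.Signed as ℤ∣ using (divides; ∣⇒∣ᵤ)
import Data.Integer.Tactic.RingSolver as ℤSolver
open import Data.Rational as ℚ using (ℚ; _/_)
import Data.Rational.Properties as ℚP
import Data.Rational.Unnormalised as ℚᵘ
open import Algebra.Properties.Group ℚP.+-0-group using (x∙y⁻¹≈ε⇒x≈y)
open import Algebra.Apartness.Properties.HeytingCommutativeRing ℚP.heytingCommutativeRing
  using (x#0y#0→xy#0)
open import Data.Fin as Fin using (Fin; toℕ; fromℕ; fromℕ<)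
import Data.Fin.Properties as FinP
open import Data.List using (List; []; _∷_; allFin; filter; tabulate; upTo)
open import Data.Bool using (true; false; T; if_then_else_)
open import Data.Bool.Properties using (T-∧)
open import Data.Product using (_,_; proj₂)
open import Function using (_∘_; _⇔_; mk⇔; Equivalence)
open import Relation.Nullary using (¬_; yes; no; does)
open import Relation.Unary using (Pred; Decidable)
open import Relation.Binary.PropositionalEquality using (refl; sym; trans; cong; subst; cong₂; module ≡-Reasoning)
open ≡-Reasoning

ΠQ-≢0 : ∀ {A : Set} (xs : List A) {f : A → ℚ} → (∀ x → f x ≢ 0ℚ) → ΠQ xs f ≢ 0ℚ
ΠQ-≢0 []       f≢0 = ℚP.1≢0
ΠQ-≢0 (x ∷ xs) f≢0 = x#0y#0→xy#0 (f≢0 x) (ΠQ-≢0 xs f≢0)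

1/n≢0 : ∀ n .{{_ : NonZero n}} → + 1 / n ≢ 0ℚ
1/n≢0 n 1/n≡0 with () ← subst ℚ.Positive 1/n≡0 (ℚP.normalize-pos 1 n)

n/d≡t⇒d∣n : ∀ n d t .{{_ : NonZero d}} → n / d ≡ + t / 1 → + d ℤ∣.∣ n
n/d≡t⇒d∣n n (suc k) t eq with ℚᵘ.*≡* n*1≡t*d ← ℚP./-injective-≃ (ℚᵘ.mkℚᵘ n k) (ℚᵘ.mkℚᵘ (+ t) 0) eq =
  divides (+ t) (trans (sym (ℤP.*-identityʳ n)) n*1≡t*d)

+d∣n-n%ℕd : ∀ n d .{{_ : NonZero d}} → + d ℤ∣.∣ n ℤ.- + (n %ℕ d)
+d∣n-n%ℕd n d = divides (n /ℕ d) (begin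
  n ℤ.- + ρ                            ≡⟨ cong (ℤ._- + ρ) (a≡a%ℕn+[a/ℕn]*n n d) ⟩
  (+ ρ ℤ.+ (n /ℕ d) ℤ.* + d) ℤ.- + ρ  ≡⟨ cancel (+ ρ) (n /ℕ d ℤ.* + d) ⟩
  n /ℕ d ℤ.* + d                       ∎)
  where
  ρ = n %ℕ d
  cancel : ∀ x y → (x ℤ.+ y) ℤ.- x ≡ y
  cancel = ℤSolver.solve-∀

∣[-[c-1]%ℕd-1]⇒∣c : ∀ c d .{{_ : NonZero d}} →
  + d ℤ∣.∣ + (ℤ.- (c ℤ.- + 1) %ℕ d) ℤ.- + 1 → + d ℤ∣.∣ c
∣[-[c-1]%ℕd-1]⇒∣c c d d∣ρ-1 =
  subst (+ d ℤ∣.∣_) (sym (split c (+ ρ)))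
    (ℤ∣.∣m⇒∣-m (ℤ∣.∣m∣n⇒∣m+n (+d∣n-n%ℕd (ℤ.- (c ℤ.- + 1)) d) d∣ρ-1))
  where
  ρ = ℤ.- (c ℤ.- + 1) %ℕ d
  split : ∀ c ρ → c ≡ ℤ.- ((ℤ.- (c ℤ.- + 1) ℤ.- ρ) ℤ.+ (ρ ℤ.- + 1))
  split = ℤSolver.solve-∀

∤-coprime-* : ∀ {d r i} → Coprime d r → 0 < i → i < d → d ∤ r * i
∤-coprime-* d⊥r 0<i i<d d∣ri = ℕP.<⇒≱ i<d (∣⇒≤ (coprime-divisor d⊥r d∣ri))
  where instance _ = ℕ.>-nonZero 0<i

falling-factor-≢0 : ∀ d .{{_ : NonZero d}} r i → Coprime d r → 0 < i → i < d →
  ∀ t → (+ rr d r i 1 ℤ.- + 1) / d ℚ.- + t / 1 ≢ 0ℚ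
falling-factor-≢0 d r i d⊥r 0<i i<d t eq =
  ∤-coprime-* d⊥r 0<i i<d
    (∣⇒∣ᵤ (∣[-[c-1]%ℕd-1]⇒∣c (+ (r * i)) d (n/d≡t⇒d∣n _ d t (x∙y⁻¹≈ε⇒x≈y _ _ eq))))

hcoef-≢0 : ∀ d .{{_ : NonZero d}} r i j → Coprime d r → 0 < i → i < d →
  ∀ m → hcoef d r i j m ≢ 0ℚ
hcoef-≢0 d r i j d⊥r 0<i i<d m =
  x#0y#0→xy#0 (ΠQ-≢0 (upTo (ΣL (lowIdx d) m + δ d r i j)) (falling-factor-≢0 d r i d⊥r 0<i i<d))
              (ΠQ-≢0 (lowIdx d) (λ x → 1/n≢0 (m x !) {{m x !≢0}}))

weight : (d : ℕ) → Exps d → ℕ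
weight d m = ΣL (lowIdx d) (λ x → (d ∸ suc (toℕ x)) * m x)

T-inMᵇ⇔InM : ∀ d .{{_ : NonZero d}} r i j m → T (inMᵇ d r i j m) ⇔ InM d r i j m
T-inMᵇ⇔InM d r i j m = mk⇔
  (λ t → let (w , deg) = Equivalence.to T-w∧deg t in ℕP.≡ᵇ⇒≡ _ _ w , ℕP.≡ᵇ⇒≡ _ _ deg)
  (λ (w , deg) → Equivalence.from T-w∧deg (ℕP.≡⇒≡ᵇ _ _ w , ℕP.≡⇒≡ᵇ _ _ deg))
  where T-w∧deg = T-∧ {weight d m ℕ.≡ᵇ rr d r i j}

if-T : ∀ {A : Set} b {x y : A} → T b → (if b then x else y) ≡ x
if-T true _ = refl

if-≢else⇒T : ∀ {A : Set} b {x y : A} → (if b then x else y) ≢ y → T b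
if-≢else⇒T true  _   = _
if-≢else⇒T false x≢x = x≢x refl

Htilde-on-M : ∀ d .{{_ : NonZero d}} r i j m → InM d r i j m → Htilde d r i j m ≡ hcoef d r i j m
Htilde-on-M d r i j m m∈M = if-T (inMᵇ d r i j m) (Equivalence.from (T-inMᵇ⇔InM d r i j m) m∈M)

Htilde-support : ∀ d .{{_ : NonZero d}} r i j m → Htilde d r i j m ≢ 0ℚ → InM d r i j m
Htilde-support d r i j m nz = Equivalence.to (T-inMᵇ⇔InM d r i j m) (if-≢else⇒T (inMᵇ d r i j m) nz)

Htilde-homogeneous : ∀ d .{{_ : NonZero d}} r i j → IsHomogeneous (Htilde d r i j) d
Htilde-homogeneous d r i j m = proj₂ ∘ Htilde-support d r i j m

module _ {A : Set} where

  ΣL-cong : ∀ (xs : List A) {f g : A → ℕ} → (∀ x → f x ≡ g x) → ΣL xs f ≡ ΣL xs g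
  ΣL-cong []       f≗g = refl
  ΣL-cong (x ∷ xs) f≗g = cong₂ _+_ (f≗g x) (ΣL-cong xs f≗g)

  ΣL-zero : ∀ (xs : List A) → ΣL xs (λ _ → 0) ≡ 0
  ΣL-zero []       = refl
  ΣL-zero (x ∷ xs) = ΣL-zero xs

  ΣL-+ : ∀ (xs : List A) (f g : A → ℕ) → ΣL xs (λ x → f x + g x) ≡ ΣL xs f + ΣL xs g
  ΣL-+ []       f g = refl
  ΣL-+ (x ∷ xs) f g = trans (cong (_+_ (f x + g x)) (ΣL-+ xs f g)) (interchange (f x) (g x) _ _)
    where
    interchange : ∀ a b c e → (a + b) + (c + e) ≡ (a + c) + (b + e)
    interchange = ℕSolver.solve-∀

  ΣL-*ˡ : ∀ (xs : List A) c (f : A → ℕ) → ΣL xs (λ x → c * f x) ≡ c * ΣL xs f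
  ΣL-*ˡ []       c f = sym (ℕP.*-zeroʳ c)
  ΣL-*ˡ (x ∷ xs) c f = trans (cong (_+_ (c * f x)) (ΣL-*ˡ xs c f)) (sym (ℕP.*-distribˡ-+ c (f x) _))

  ΣL-filter : ∀ {ℓ} {P : Pred A ℓ} (P? : Decidable P) (xs : List A) {f : A → ℕ} →
    (∀ x → ¬ P x → f x ≡ 0) → ΣL (filter P? xs) f ≡ ΣL xs f
  ΣL-filter P? []                 f≡0 = refl
  ΣL-filter P? (x ∷ xs) {f = f} f≡0 with P? x
  ... | yes _  = cong (_+_ (f x)) (ΣL-filter P? xs f≡0)
  ... | no ¬px = trans (ΣL-filter P? xs f≡0) (cong (λ y → y + ΣL xs f) (sym (f≡0 x ¬px)))

ΣL-tabulate : ∀ {A : Set} {n} (h : Fin n → A) (f : A → ℕ) → ΣL (tabulate h) f ≡ ΣL (allFin n) (f ∘ h)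
ΣL-tabulate {n = zero}  h f = refl
ΣL-tabulate {n = suc n} h f = cong (_+_ (f (h Fin.zero)))
  (trans (ΣL-tabulate (h ∘ Fin.suc) f) (sym (ΣL-tabulate Fin.suc (f ∘ h))))

basis : ∀ {n} → Fin n → Exps n
basis p x = if does (x Fin.≟ p) then 1 else 0

ΣL-basis : ∀ {n} (p : Fin n) (f : Fin n → ℕ) → ΣL (allFin n) (λ x → basis p x * f x) ≡ f p
ΣL-basis {suc n} Fin.zero f = begin
  f Fin.zero + 0 + ΣL (tabulate Fin.suc) b*f ≡⟨ cong₂ _+_ (ℕP.+-identityʳ _) (ΣL-tabulate Fin.suc b*f) ⟩
  f Fin.zero + ΣL (allFin n) (λ _ → 0)      ≡⟨ cong (_+_ (f Fin.zero)) (ΣL-zero (allFin n)) ⟩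
  f Fin.zero + 0                            ≡⟨ ℕP.+-identityʳ _ ⟩
  f Fin.zero                                ∎
  where b*f = λ x → basis Fin.zero x * f x
ΣL-basis {suc n} (Fin.suc p) f =
  trans (ΣL-tabulate Fin.suc (λ x → basis (Fin.suc p) x * f x)) (ΣL-basis p (f ∘ Fin.suc))

ΣL-basis≡1 : ∀ {n} (p : Fin n) → ΣL (allFin n) (basis p) ≡ 1
ΣL-basis≡1 p = trans (ΣL-cong (allFin _) (λ x → sym (ℕP.*-identityʳ (basis p x)))) (ΣL-basis p (λ _ → 1))

module _ (n ρ : ℕ) where

  private
    d = suc n
    last = fromℕ n
    n∸ρ<d = s≤s (ℕP.m∸n≤m n ρ)
    p = fromℕ< n∸ρ<d

  witness : Exps d
  witness x = n * basis last x + basis p x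

  totDeg-witness : totDeg witness ≡ d
  totDeg-witness = begin
    ΣL (allFin d) (λ x → n * basis last x + basis p x)
      ≡⟨ ΣL-+ (allFin d) (λ x → n * basis last x) (basis p) ⟩
    ΣL (allFin d) (λ x → n * basis last x) + ΣL (allFin d) (basis p)
      ≡⟨ cong₂ _+_ (ΣL-*ˡ (allFin d) n (basis last)) refl ⟩
    n * ΣL (allFin d) (basis last) + ΣL (allFin d) (basis p)
      ≡⟨ cong₂ (λ a b → n * a + b) (ΣL-basis≡1 last) (ΣL-basis≡1 p) ⟩
    n * 1 + 1
      ≡⟨ cong (_+ 1) (ℕP.*-identityʳ n) ⟩
    n + 1
      ≡⟨ ℕP.+-comm n 1 ⟩
    d ∎

  weight-witness : ρ ≤ n → weight d witness ≡ ρ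
  weight-witness ρ≤n = begin
    weight d witness
      ≡⟨ ΣL-filter (λ x → suc (toℕ x) ℕ.<? d) (allFin d) unlisted-weight-0 ⟩
    ΣL (allFin d) (λ x → w x * witness x)
      ≡⟨ ΣL-cong (allFin d) (λ x → distrib n (w x) (basis last x) (basis p x)) ⟩
    ΣL (allFin d) (λ x → n * (basis last x * w x) + basis p x * w x)
      ≡⟨ ΣL-+ (allFin d) (λ x → n * (basis last x * w x)) (λ x → basis p x * w x) ⟩
    ΣL (allFin d) (λ x → n * (basis last x * w x)) + ΣL (allFin d) (λ x → basis p x * w x)
      ≡⟨ cong₂ _+_ (ΣL-*ˡ (allFin d) n (λ x → basis last x * w x)) refl ⟩
    n * ΣL (allFin d) (λ x → basis last x * w x) + ΣL (allFin d) (λ x → basis p x * w x)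
      ≡⟨ cong₂ (λ a b → n * a + b) (ΣL-basis last w) (ΣL-basis p w) ⟩
    n * w last + w p
      ≡⟨ cong₂ (λ a b → n * a + b) w-last w-p ⟩
    n * 0 + ρ
      ≡⟨ cong (_+ ρ) (ℕP.*-zeroʳ n) ⟩
    ρ ∎
    where
    w : Fin d → ℕ
    w x = d ∸ suc (toℕ x)
    unlisted-weight-0 : ∀ x → ¬ suc (toℕ x) < d → w x * witness x ≡ 0
    unlisted-weight-0 x x≮d = cong (_* witness x) (ℕP.m≤n⇒m∸n≡0 (ℕP.≮⇒≥ x≮d))
    distrib : ∀ k a b c → a * (k * b + c) ≡ k * (b * a) + c * a
    distrib = ℕSolver.solve-∀
    w-last : w last ≡ 0
    w-last = trans (cong (n ∸_) (FinP.toℕ-fromℕ n)) (ℕP.n∸n≡0 n)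
    w-p : w p ≡ ρ
    w-p = trans (cong (n ∸_) (FinP.toℕ-fromℕ< n∸ρ<d)) (ℕP.m∸[m∸n]≡n ρ≤n)

lemma4p1 : (d : ℕ) .{{_ : NonZero d}} (r i j : ℕ) →
    2 ≤ d → 1 ≤ r → r ≤ d ∸ 1 → gcd r d ≡ 1 →
    1 ≤ i → i ≤ d ∸ 1 → 1 ≤ j → j ≤ d ∸ 1 →
    (IsNonzeroPoly (Htilde d r i j) × IsHomogeneous (Htilde d r i j) d)
    × (∀ m → InM d r i j m → hcoef d r i j m ≢ 0ℚ)
lemma4p1 d@(suc n) r i j _ _ _ gcd≡1 0<i i≤n _ _ =
  ((witness n ρ , Htilde≢0) , Htilde-homogeneous d r i j) , λ m _ → hcoef≢0 m
  where
  ρ = rr d r i j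
  hcoef≢0 : ∀ m → hcoef d r i j m ≢ 0ℚ
  hcoef≢0 = hcoef-≢0 d r i j (Coprimality.sym (gcd≡1⇒coprime gcd≡1)) 0<i (s≤s i≤n)
  witness∈M : InM d r i j (witness n ρ)
  witness∈M = weight-witness n ρ (ℕP.≤-pred (n%ℕd<d (ℤ.- (+ (r * i) ℤ.- + j)) d))
            , totDeg-witness n ρ
  Htilde≢0 : Htilde d r i j (witness n ρ) ≢ 0ℚ
  Htilde≢0 = subst (_≢ 0ℚ) (sym (Htilde-on-M d r i j _ witness∈M)) (hcoef≢0 (witness n ρ))
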